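{- Let $G$ be a graph with $\alpha(G)=3$ and let $H=\overline G$. Then $G$ is $\alpha$-critical and belongs to $\mathbf W_p$ if and only if (a) $H$ is $K_4$-saturated, (b) every maximal clique of $H$ is a triangle, and (c) every edge of $H$ is contained in at least $p$ triangles of $H$. Moreover, $\operatorname{w}(G)$ equals the minimum, over edges of $H$, of the number of triangles of $H$ containing that edge.
   Context: All graphs are finite, simple and non-empty; $p\ge1$ is an integer. $\alpha(G)$ is the independence number. $G\in\mathbf W_p$ means: $|V(G)|\ge p$ and any $p$ pairwise disjoint independent sets $A_1,\dots,A_p$ extend to pairwise disjoint maximum independent sets $M_i\supseteq A_i$. An edge $e$ is $\alpha$-critical if $\alpha(G-e)>\alpha(G)$; $G$ is $\alpha$-critical if all edges are. $H$ is $K_4$-saturated if it contains no $K_4$ and adding any non-edge creates a $K_4$. For well-covered $G$ (all maximal independent sets of size $\alpha(G)$), $\operatorname{w}(G)=\max\{p\ge1:G\in\mathbf W_p\}$. -}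

module Defs where

open import Data.Nat using (ℕ; suc; _≤_; _<_)
open import Data.Bool using (Bool; true; false; _∧_; _∨_; not)
open import Data.Bool.Properties using (∧-comm; ∨-comm; ∧-zeroʳ; ∧-zeroˡ; ∨-zeroʳ)
open import Data.Fin using (Fin; _≟_)
open import Data.Fin.Subset using (Subset; _∈_; _⊆_; ∣_∣)
open import Data.Vec using (tabulate)
open import Data.Product using (Σ; ∃; _×_; _,_)
open import Data.Empty using (⊥)
open import Relation.Nullary using (does; ¬_; yes; no)
open import Relation.Binary.PropositionalEquality using (_≡_; _≢_; refl; sym; cong; cong₂; trans)

record Graph (n : ℕ) : Set where
  field
    adj    : Fin n → Fin n → Bool
    adj-sym : ∀ x y → adj x y ≡ adj y x
    irrefl : ∀ x → adj x x ≡ false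
open Graph public

_==_ : ∀ {n} → Fin n → Fin n → Bool
x == y = does (x ≟ y)

==-sym : ∀ {n} (x y : Fin n) → (x == y) ≡ (y == x)
==-sym x y with x ≟ y | y ≟ x
... | yes _ | yes _ = refl
... | no _  | no _  = refl
... | yes p | no q  with q (sym p)
... | ()
==-sym x y | no q | yes p with q (sym p)
... | ()

==-refl : ∀ {n} (x : Fin n) → (x == x) ≡ true
==-refl x with x ≟ x
... | yes _ = refl
... | no q with q refl
... | ()

isPair : ∀ {n} → Fin n → Fin n → Fin n → Fin n → Bool
isPair u v x y = ((x == u) ∧ (y == v)) ∨ ((x == v) ∧ (y == u))

isPair-sym : ∀ {n} (u v x y : Fin n) → isPair u v x y ≡ isPair u v y x
isPair-sym u v x y = trans
  (cong₂ _∨_ (∧-comm (x == u) (y == v)) (∧-comm (x == v) (y == u)))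
  (∨-comm ((y == v) ∧ (x == u)) ((y == u) ∧ (x == v)))

complement : ∀ {n} → Graph n → Graph n
complement G = record
  { adj    = λ x y → not (adj G x y) ∧ not (x == y)
  ; adj-sym = λ x y → cong₂ (λ a b → not a ∧ not b) (adj-sym G x y) (==-sym x y)
  ; irrefl = λ x → trans (cong (λ b → not (adj G x x) ∧ not b) (==-refl x))
                         (∧-zeroʳ (not (adj G x x)))
  }

deleteEdge : ∀ {n} → Graph n → Fin n → Fin n → Graph n
deleteEdge G u v = record
  { adj    = λ x y → adj G x y ∧ not (isPair u v x y)
  ; adj-sym = λ x y → cong₂ (λ a b → a ∧ not b) (adj-sym G x y) (isPair-sym u v x y)
  ; irrefl = λ x → cong (λ a → a ∧ not (isPair u v x x)) (irrefl G x)
  }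

addEdge : ∀ {n} → Graph n → Fin n → Fin n → Graph n
addEdge G u v = record
  { adj    = λ x y → adj G x y ∨ (isPair u v x y ∧ not (x == y))
  ; adj-sym = λ x y → cong₂ (λ a b → a ∨ b) (adj-sym G x y)
                        (cong₂ (λ a b → a ∧ not b) (isPair-sym u v x y) (==-sym x y))
  ; irrefl = λ x → trans (cong₂ (λ a b → a ∨ (isPair u v x x ∧ not b)) (irrefl G x) (==-refl x))
                         (∧-zeroʳ (isPair u v x x))
  }

Independent : ∀ {n} → Graph n → Subset n → Set
Independent G A = ∀ x y → x ∈ A → y ∈ A → adj G x y ≡ false

IsAlpha : ∀ {n} → Graph n → ℕ → Set
IsAlpha G k = (Σ _ λ A → Independent G A × ∣ A ∣ ≡ k)
            × (∀ A → Independent G A → ∣ A ∣ ≤ k)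

MaximumIndep : ∀ {n} → Graph n → Subset n → Set
MaximumIndep G A = Independent G A × (∀ B → Independent G B → ∣ B ∣ ≤ ∣ A ∣)

MaximalIndep : ∀ {n} → Graph n → Subset n → Set
MaximalIndep G A = Independent G A × (∀ B → Independent G B → A ⊆ B → B ⊆ A)

WellCovered : ∀ {n} → Graph n → Set
WellCovered G = ∀ A → MaximalIndep G A → MaximumIndep G A

Disjoint : ∀ {n} → Subset n → Subset n → Set
Disjoint A B = ∀ x → x ∈ A → x ∈ B → ⊥

W : ∀ {n} → Graph n → ℕ → Set
W {n} G p = p ≤ n ×
  (∀ (A : Fin p → Subset n)
   → (∀ i → Independent G (A i))
   → (∀ i j → i ≢ j → Disjoint (A i) (A j))
   → Σ (Fin p → Subset n) λ M →
       (∀ i → MaximumIndep G (M i) × A i ⊆ M i)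
       × (∀ i j → i ≢ j → Disjoint (M i) (M j)))

AlphaCriticalEdge : ∀ {n} → Graph n → Fin n → Fin n → Set
AlphaCriticalEdge G u v =
  ∀ k → IsAlpha G k → Σ _ λ B → Independent (deleteEdge G u v) B × k < ∣ B ∣

AlphaCritical : ∀ {n} → Graph n → Set
AlphaCritical G = ∀ u v → adj G u v ≡ true → AlphaCriticalEdge G u v

IsW : ∀ {n} → Graph n → ℕ → Set
IsW G m = 1 ≤ m × W G m × (∀ p → 1 ≤ p → W G p → p ≤ m)

Clique : ∀ {n} → Graph n → Subset n → Set
Clique H C = ∀ x y → x ∈ C → y ∈ C → x ≢ y → adj H x y ≡ true

MaximalClique : ∀ {n} → Graph n → Subset n → Set
MaximalClique H C = Clique H C × (∀ D → Clique H D → C ⊆ D → D ⊆ C)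

-- H contains a K4 (four pairwise adjacent, hence distinct, vertices)
HasK4 : ∀ {n} → Graph n → Set
HasK4 H = Σ _ λ a → Σ _ λ b → Σ _ λ c → Σ _ λ d →
  adj H a b ≡ true × adj H a c ≡ true × adj H a d ≡ true ×
  adj H b c ≡ true × adj H b d ≡ true × adj H c d ≡ true

K4Saturated : ∀ {n} → Graph n → Set
K4Saturated H = ¬ HasK4 H ×
  (∀ u v → u ≢ v → adj H u v ≡ false → HasK4 (addEdge H u v))

-- number of triangles of H containing the pair {u,v}:
-- the number of vertices z adjacent to both u and v
triangleCount : ∀ {n} → Graph n → Fin n → Fin n → ℕ
triangleCount H u v = ∣ tabulate (λ z → adj H u z ∧ adj H v z) ∣

IsMinTriangleCount : ∀ {n} → Graph n → ℕ → Set
IsMinTriangleCount H m =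
  (Σ _ λ u → Σ _ λ v → adj H u v ≡ true × triangleCount H u v ≡ m)
  × (∀ u v → adj H u v ≡ true → m ≤ triangleCount H u v)

-- Independent sets of G are exactly the cliques of H, so α(G) = 3 makes H K4-free, and an
-- edge uv of G is α-critical exactly when G − uv has an independent 4-set, i.e. H + uv has a K4.
-- If G ∈ W_p, every maximal clique of H extends to a maximum independent set of G, hence is a
-- triangle; and if an edge uv of H lay in fewer than p triangles, putting {u, v} in one set and
-- the common neighbours of u and v in singletons of the other p − 1 sets would leave the maximum
-- set through u and v without a third vertex. Conversely, as H is K4-free the common neighbours
-- of an edge of H are pairwise adjacent in G, so each of the other p − 1 sets holds at most one
-- of them; with at least p of them one is always free, and enlarging the sets one at a time by
-- free common neighbours of an edge covering the current set produces the required disjoint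
-- triangles. Hence w(G) is the largest p with every edge of H in p triangles.

module Submission where

open import Defs
open import Data.Nat using (ℕ; zero; suc; _+_; _≤_; _<_; z≤n; s≤s; _≤?_)
open import Data.Nat.Properties
open import Data.Bool using (Bool; true; false; not; _∧_; _∨_)
import Data.Bool as Bool
open import Data.Bool.Properties using (∨-identityʳ; ∨-idem)
open import Data.Fin using (Fin; zero; suc; punchIn; punchOut) renaming (_≟_ to _≟ᶠ_)
open import Data.Fin.Properties using (any?; all?; punchInᵢ≢i; punchIn-punchOut)
open import Data.Fin.Subset
  using (Subset; ∣_∣; _∈_; _∉_; _⊆_; _⊂_; ⁅_⁆; _∪_; _∩_; _-_; Nonempty) renaming (⊥ to ∅)
open import Data.Fin.Subset.Properties
open import Data.Vec using (_∷_; here; there; tabulate)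
open import Data.Vec.Properties using (lookup⇒[]=; []=⇒lookup; lookup∘tabulate)
open import Data.Vec.Functional using (updateAt)
open import Data.Vec.Functional.Properties using (updateAt-updates; updateAt-minimal)
open import Data.List using (List; []; _∷_; length; allFin; filter; cartesianProduct)
open import Data.List.Extrema.Nat using (argmin; argmin-all; f[argmin]≤f[xs])
open import Data.List.Membership.Propositional using () renaming (_∈_ to _∈ₗ_)
open import Data.List.Membership.Propositional.Properties
  using (∈-allFin; ∈-filter⁺; ∈-cartesianProduct⁺)
open import Data.List.Relation.Unary.All as All using (All; []; _∷_)
open import Data.List.Relation.Unary.All.Properties using (¬Any⇒All¬; all-filter)
open import Data.List.Relation.Unary.AllPairs as AllPairs using (AllPairs; []; _∷_)
open import Data.List.Relation.Unary.Any as Any using (here; there)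
open import Data.List.Relation.Unary.Any.Properties using (singleton⁻)
open import Data.Product using (∃; _×_; _,_; proj₁; proj₂)
open import Data.Sum using (_⊎_; inj₁; inj₂)
open import Data.Empty using (⊥; ⊥-elim)
open import Function.Base using (_∘_; id; const)
open import Function.Bundles using (_⇔_; mk⇔; Equivalence)
open import Relation.Binary.Definitions using (Symmetric)
open import Relation.Unary using (Decidable)
open import Relation.Nullary using (¬_; yes; no; contradiction)
open import Relation.Nullary.Decidable using (dec-false; ¬?; _×-dec_; _→-dec_)
open import Relation.Binary.PropositionalEquality
  using (_≡_; _≢_; refl; sym; trans; cong; cong₂; subst; subst₂)

private
  variable
    n : ℕ

Adjacent : Graph n → Fin n → Fin n → Set
Adjacent K x y = adj K x y ≡ true

module _ (K : Graph n) where

  adjacent-sym : Symmetric (Adjacent K)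
  adjacent-sym {x} {y} xy = trans (adj-sym K y x) xy

  adjacent⇒≢ : ∀ {x y} → Adjacent K x y → x ≢ y
  adjacent⇒≢ {x} xy refl = contradiction (trans (sym xy) (irrefl K x)) λ ()

  complement-adjacent⁺ : ∀ {x y} → adj K x y ≡ false → x ≢ y → Adjacent (complement K) x y
  complement-adjacent⁺ {x} {y} xy x≢y rewrite xy | dec-false (x ≟ᶠ y) x≢y = refl

  complement-adjacent⁻ : ∀ {x y} → Adjacent (complement K) x y → adj K x y ≡ false
  complement-adjacent⁻ {x} {y} xy with adj K x y
  ... | false = refl

  complement-nonadjacent⁻ : ∀ {x y} → adj (complement K) x y ≡ false → x ≢ y → Adjacent K x y
  complement-nonadjacent⁻ {x} {y} xy x≢y with adj K x y
  ... | true  = refl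
  ... | false = contradiction (trans (sym xy) (cong not (dec-false (x ≟ᶠ y) x≢y))) λ ()

  adjacent⇒complement-nonadjacent : ∀ {x y} → Adjacent K x y → adj (complement K) x y ≡ false
  adjacent⇒complement-nonadjacent xy rewrite xy = refl

  independent⇒complement-clique : ∀ {C} → Independent K C → Clique (complement K) C
  independent⇒complement-clique C-indep x y x∈C y∈C = complement-adjacent⁺ (C-indep x y x∈C y∈C)

  complement-clique⇒independent : ∀ {C} → Clique (complement K) C → Independent K C
  complement-clique⇒independent C-clique x y x∈C y∈C with x ≟ᶠ y
  ... | yes refl = irrefl K x
  ... | no x≢y   = complement-adjacent⁻ (C-clique x y x∈C y∈C x≢y)

addEdge-complement : ∀ (K : Graph n) u v x y →
  adj (addEdge (complement K) u v) x y ≡ adj (complement (deleteEdge K u v)) x y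
addEdge-complement K u v x y = identity (adj K x y) (isPair u v x y) (x == y)
  where
  identity : ∀ a p e → ((not a ∧ not e) ∨ (p ∧ not e)) ≡ (not (a ∧ not p) ∧ not e)
  identity false false e = ∨-identityʳ (not e)
  identity false true  e = ∨-idem (not e)
  identity true  false e = refl
  identity true  true  e = refl

HasK4-resp : ∀ {K L : Graph n} → (∀ x y → adj K x y ≡ adj L x y) → HasK4 K → HasK4 L
HasK4-resp {K = K} {L} K≗L (a , b , c , d , ab , ac , ad , bc , bd , cd) =
  a , b , c , d , t ab , t ac , t ad , t bc , t bd , t cd
  where
  t : ∀ {x y} → Adjacent K x y → Adjacent L x y
  t {x} {y} xy = trans (sym (K≗L x y)) xy

HasK4-addEdge-complement : ∀ (K : Graph n) u v →
  HasK4 (addEdge (complement K) u v) ⇔ HasK4 (complement (deleteEdge K u v))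
HasK4-addEdge-complement K u v = mk⇔
  (HasK4-resp {K = K+uv} {L = K-uvᶜ} (addEdge-complement K u v))
  (HasK4-resp {K = K-uvᶜ} {L = K+uv} λ x y → sym (addEdge-complement K u v x y))
  where
  K+uv  = addEdge (complement K) u v
  K-uvᶜ = complement (deleteEdge K u v)

∣s∷p∣≤1+∣p∣ : ∀ s (p : Subset n) → ∣ s ∷ p ∣ ≤ suc ∣ p ∣
∣s∷p∣≤1+∣p∣ true  p = ≤-refl
∣s∷p∣≤1+∣p∣ false p = n≤1+n ∣ p ∣

∣p∣≤1+∣p-x∣ : ∀ (p : Subset n) x → ∣ p ∣ ≤ suc ∣ p - x ∣
∣p∣≤1+∣p-x∣ (s ∷ p)     zero    =
  ≤-trans (∣s∷p∣≤1+∣p∣ s p) (s≤s (≤-reflexive (cong ∣_∣ (sym (p─⊥≡p p)))))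
∣p∣≤1+∣p-x∣ (true ∷ p)  (suc x) = s≤s (∣p∣≤1+∣p-x∣ p x)
∣p∣≤1+∣p-x∣ (false ∷ p) (suc x) = ∣p∣≤1+∣p-x∣ p x

x∉p-x : ∀ {p : Subset n} x → x ∉ p - x
x∉p-x {p = s ∷ p} (suc x) (there x∈p-x) = x∉p-x x x∈p-x

x∈p-y⇒x≢y : ∀ {p : Subset n} {x y} → x ∈ p - y → x ≢ y
x∈p-y⇒x≢y {x = x} x∈p-x refl = x∉p-x x x∈p-x

nonempty⁺ : ∀ {p : Subset n} → 0 < ∣ p ∣ → Nonempty p
nonempty⁺ {n} {p} 0<∣p∣ with nonempty? p
... | yes ne  = ne
... | no ¬ne = contradiction (trans (cong ∣_∣ (Empty-unique ¬ne)) (∣⊥∣≡0 n)) (>⇒≢ 0<∣p∣)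

∃-other : ∀ {p : Subset n} u v → 2 < ∣ p ∣ → ∃ λ z → z ∈ p × z ≢ u × z ≢ v
∃-other {p = p} u v 2<∣p∣ with nonempty⁺ {p = p - u - v} (≤-pred (≤-pred ∣p∣≤2+∣p-u-v∣))
  where
  ∣p∣≤2+∣p-u-v∣ : 3 ≤ 2 + ∣ p - u - v ∣
  ∣p∣≤2+∣p-u-v∣ = ≤-trans 2<∣p∣ (≤-trans (∣p∣≤1+∣p-x∣ p u) (s≤s (∣p∣≤1+∣p-x∣ (p - u) v)))
... | z , z∈p-u-v = z , p─q⊆p p ⁅ u ⁆ z∈p-u , x∈p-y⇒x≢y z∈p-u , x∈p-y⇒x≢y z∈p-u-v
  where
  z∈p-u = p─q⊆p (p - u) ⁅ v ⁆ z∈p-u-v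

distinct⊆⇒length≤∣p∣ : ∀ {p : Subset n} {xs} → All (_∈ p) xs → AllPairs _≢_ xs → length xs ≤ ∣ p ∣
distinct⊆⇒length≤∣p∣ []                [] = z≤n
distinct⊆⇒length≤∣p∣ {p = p} (x∈p ∷ xs⊆p) (x≢xs ∷ xs-distinct) =
  ≤-trans (s≤s (distinct⊆⇒length≤∣p∣ xs⊆p-x xs-distinct)) (x∈p⇒∣p-x∣<∣p∣ x∈p)
  where
  xs⊆p-x = All.zipWith (λ (y∈p , x≢y) → x∈p∧x≢y⇒x∈p-y y∈p (x≢y ∘ sym)) (xs⊆p , x≢xs)

∃-distinct⊆ : ∀ k {p : Subset n} → k ≤ ∣ p ∣ →
  ∃ λ xs → length xs ≡ k × All (_∈ p) xs × AllPairs _≢_ xs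
∃-distinct⊆ zero    _ = [] , refl , [] , []
∃-distinct⊆ (suc k) {p} k<∣p∣ with nonempty⁺ (≤-trans (s≤s z≤n) k<∣p∣)
... | x , x∈p with ∃-distinct⊆ k {p - x} (≤-pred (≤-trans k<∣p∣ (∣p∣≤1+∣p-x∣ p x)))
... | xs , refl , xs⊆p-x , distinct =
  x ∷ xs , refl , x∈p ∷ All.map (p─q⊆p p ⁅ x ⁆) xs⊆p-x ,
  All.map (λ y∈p-x x≡y → x∈p-y⇒x≢y y∈p-x (sym x≡y)) xs⊆p-x ∷ distinct

enumeration : ∀ (p : Subset n) → ∃ λ xs →
  length xs ≡ ∣ p ∣ × All (_∈ p) xs × AllPairs _≢_ xs × (∀ {z} → z ∈ p → z ∈ₗ xs)
enumeration p with ∃-distinct⊆ ∣ p ∣ ≤-refl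
... | xs , len , xs⊆p , distinct = xs , len , xs⊆p , distinct , complete
  where
  complete : ∀ {z} → z ∈ p → z ∈ₗ xs
  complete {z} z∈p with Any.any? (z ≟ᶠ_) xs
  ... | yes z∈xs = z∈xs
  ... | no  z∉xs = contradiction
    (subst (_< ∣ p ∣) len (distinct⊆⇒length≤∣p∣ (z∈p ∷ xs⊆p) (¬Any⇒All¬ xs z∉xs ∷ distinct)))
    (<-irrefl refl)

⟦_⟧ : List (Fin n) → Subset n
⟦ []     ⟧ = ∅
⟦ x ∷ xs ⟧ = ⁅ x ⁆ ∪ ⟦ xs ⟧

∈⟦⟧⁺ : ∀ {z : Fin n} xs → z ∈ₗ xs → z ∈ ⟦ xs ⟧
∈⟦⟧⁺ (x ∷ xs) (here refl)  = x∈p∪q⁺ (inj₁ (x∈⁅x⁆ x))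
∈⟦⟧⁺ (x ∷ xs) (there z∈xs) = x∈p∪q⁺ (inj₂ (∈⟦⟧⁺ xs z∈xs))

∈⟦⟧⁻ : ∀ {z : Fin n} xs → z ∈ ⟦ xs ⟧ → z ∈ₗ xs
∈⟦⟧⁻ []       z∈ = ⊥-elim (∉⊥ z∈)
∈⟦⟧⁻ (x ∷ xs) z∈ with x∈p∪q⁻ ⁅ x ⁆ ⟦ xs ⟧ z∈
... | inj₁ z∈⁅x⁆ = here (x∈⁅y⁆⇒x≡y x z∈⁅x⁆)
... | inj₂ z∈xs  = there (∈⟦⟧⁻ xs z∈xs)

∈-pair⁻ : ∀ {A : Set} {c x y : A} → c ∈ₗ x ∷ y ∷ [] → c ≡ x ⊎ c ≡ y
∈-pair⁻ (here c≡x)  = inj₁ c≡x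
∈-pair⁻ (there c∈y) = inj₂ (singleton⁻ c∈y)

∣⟦xs⟧∣≤length : ∀ (xs : List (Fin n)) → ∣ ⟦ xs ⟧ ∣ ≤ length xs
∣⟦xs⟧∣≤length {n} []       = ≤-reflexive (∣⊥∣≡0 n)
∣⟦xs⟧∣≤length     (x ∷ xs) =
  ≤-trans (∣p∣≤1+∣p-x∣ (⟦ x ∷ xs ⟧) x) (s≤s (≤-trans (p⊆q⇒∣p∣≤∣q∣ ⊆xs) (∣⟦xs⟧∣≤length xs)))
  where
  ⊆xs : ⟦ x ∷ xs ⟧ - x ⊆ ⟦ xs ⟧
  ⊆xs z∈ with x∈p∪q⁻ ⁅ x ⁆ ⟦ xs ⟧ (p─q⊆p _ _ z∈)
  ... | inj₁ z∈⁅x⁆ = contradiction (x∈⁅y⁆⇒x≡y x z∈⁅x⁆) (x∈p-y⇒x≢y z∈)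
  ... | inj₂ z∈xs  = z∈xs

∈tabulate⁺ : ∀ (f : Fin n → Bool) {z} → f z ≡ true → z ∈ tabulate f
∈tabulate⁺ f {z} fz = lookup⇒[]= z (tabulate f) (trans (lookup∘tabulate f z) fz)

∈tabulate⁻ : ∀ (f : Fin n → Bool) {z} → z ∈ tabulate f → f z ≡ true
∈tabulate⁻ f {z} z∈ = trans (sym (lookup∘tabulate f z)) ([]=⇒lookup z∈)

∧-≡-true⁻ : ∀ a b → a ∧ b ≡ true → a ≡ true × b ≡ true
∧-≡-true⁻ true true _ = refl , refl

Subsingleton : Subset n → Set
Subsingleton p = ∀ {x y} → x ∈ p → y ∈ p → x ≡ y

AllPairs-lookup : ∀ {A : Set} {R : A → A → Set} {xs x y} → Symmetric R →
  AllPairs R xs → x ∈ₗ xs → y ∈ₗ xs → x ≢ y → R x y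
AllPairs-lookup _ (_  ∷ _)   (here refl) (here refl) x≢x = contradiction refl x≢x
AllPairs-lookup _ (rx ∷ _)   (here refl) (there y∈) _   = All.lookup rx y∈
AllPairs-lookup s (rx ∷ _)   (there x∈) (here refl) _   = s (All.lookup rx x∈)
AllPairs-lookup s (_  ∷ rxs) (there x∈) (there y∈) x≢y = AllPairs-lookup s rxs x∈ y∈ x≢y

module _ (K : Graph n) where

  allPairs⇒clique : ∀ {xs} → AllPairs (Adjacent K) xs → Clique K ⟦ xs ⟧
  allPairs⇒clique {xs} adjacent x y x∈ y∈ =
    AllPairs-lookup (adjacent-sym K) adjacent (∈⟦⟧⁻ xs x∈) (∈⟦⟧⁻ xs y∈)

  HasK4⇒clique : HasK4 K → ∃ λ C → Clique K C × 4 ≤ ∣ C ∣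
  HasK4⇒clique (a , b , c , d , ab , ac , ad , bc , bd , cd) =
    ⟦ xs ⟧ , allPairs⇒clique adjacent ,
    distinct⊆⇒length≤∣p∣ (All.tabulate (∈⟦⟧⁺ xs)) (AllPairs.map (adjacent⇒≢ K) adjacent)
    where
    xs = a ∷ b ∷ c ∷ d ∷ []
    adjacent : AllPairs (Adjacent K) xs
    adjacent = (ab ∷ ac ∷ ad ∷ []) ∷ (bc ∷ bd ∷ []) ∷ (cd ∷ []) ∷ [] ∷ []

  clique⇒allPairs : ∀ {C xs} → Clique K C → All (_∈ C) xs → AllPairs _≢_ xs →
    AllPairs (Adjacent K) xs
  clique⇒allPairs C-clique []         []                  = []
  clique⇒allPairs C-clique (x∈ ∷ xs⊆) (x≢xs ∷ distinct) =
    All.zipWith (λ (y∈ , x≢y) → C-clique _ _ x∈ y∈ x≢y) (xs⊆ , x≢xs) ∷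
    clique⇒allPairs C-clique xs⊆ distinct

  allPairs⇒HasK4 : ∀ xs → length xs ≡ 4 → AllPairs (Adjacent K) xs → HasK4 K
  allPairs⇒HasK4 (a ∷ b ∷ c ∷ d ∷ []) refl
    ((ab ∷ ac ∷ ad ∷ []) ∷ (bc ∷ bd ∷ []) ∷ (cd ∷ []) ∷ [] ∷ []) =
    a , b , c , d , ab , ac , ad , bc , bd , cd

  clique⇒HasK4 : ∀ {C} → Clique K C → 4 ≤ ∣ C ∣ → HasK4 K
  clique⇒HasK4 C-clique 4≤∣C∣ =
    let xs , len , xs⊆C , distinct = ∃-distinct⊆ 4 4≤∣C∣
    in allPairs⇒HasK4 xs len (clique⇒allPairs C-clique xs⊆C distinct)

-- The independence number and α-critical edges

module _ (G : Graph n) where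

  IsAlpha-unique : ∀ {k m} → IsAlpha G k → IsAlpha G m → k ≡ m
  IsAlpha-unique ((A , A-indep , ∣A∣≡k) , ≤k) ((B , B-indep , ∣B∣≡m) , ≤m) =
    ≤-antisym (subst (_≤ _) ∣A∣≡k (≤m A A-indep)) (subst (_≤ _) ∣B∣≡m (≤k B B-indep))

  maximum⇒IsAlpha : ∀ {M} → MaximumIndep G M → IsAlpha G ∣ M ∣
  maximum⇒IsAlpha {M} (M-indep , M-max) = (M , M-indep , refl) , M-max

  large⇒maximum : ∀ {k M} → IsAlpha G k → Independent G M → k ≤ ∣ M ∣ → MaximumIndep G M
  large⇒maximum (_ , ≤k) M-indep k≤∣M∣ = M-indep , λ B B-indep → ≤-trans (≤k B B-indep) k≤∣M∣

  maximum-⊆ : ∀ {M M′} → MaximumIndep G M → M ⊆ M′ → Independent G M′ → MaximumIndep G M′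
  maximum-⊆ (_ , M-max) M⊆M′ M′-indep =
    M′-indep , λ B B-indep → ≤-trans (M-max B B-indep) (p⊆q⇒∣p∣≤∣q∣ M⊆M′)

module _ (G : Graph n) (α3 : IsAlpha G 3) where

  ¬HasK4-complement : ¬ HasK4 (complement G)
  ¬HasK4-complement K4 with HasK4⇒clique (complement G) K4
  ... | C , C-clique , 4≤∣C∣ =
    <⇒≱ 4≤∣C∣ (proj₂ α3 C (complement-clique⇒independent G C-clique))

  criticalEdge⇒K4 : ∀ {u v} → AlphaCriticalEdge G u v → HasK4 (addEdge (complement G) u v)
  criticalEdge⇒K4 {u} {v} critical with critical 3 α3
  ... | B , B-indep , 3<∣B∣ =
    Equivalence.from (HasK4-addEdge-complement G u v)
      (clique⇒HasK4 (complement (deleteEdge G u v))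
        (independent⇒complement-clique (deleteEdge G u v) B-indep) 3<∣B∣)

  K4⇒criticalEdge : ∀ {u v} → HasK4 (addEdge (complement G) u v) → AlphaCriticalEdge G u v
  K4⇒criticalEdge {u} {v} K4 k αk
    with HasK4⇒clique (complement (deleteEdge G u v))
           (Equivalence.to (HasK4-addEdge-complement G u v) K4)
  ... | C , C-clique , 4≤∣C∣ =
    C , complement-clique⇒independent (deleteEdge G u v) C-clique ,
    subst (_< ∣ C ∣) (IsAlpha-unique G α3 αk) 4≤∣C∣

  alphaCritical⇔K4Saturated : AlphaCritical G ⇔ K4Saturated (complement G)
  alphaCritical⇔K4Saturated = mk⇔
    (λ critical → ¬HasK4-complement , λ u v u≢v uv →
      criticalEdge⇒K4 (critical u v (complement-nonadjacent⁻ G uv u≢v)))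
    (λ (_ , saturated) u v uv →
      K4⇒criticalEdge (saturated u v (adjacent⇒≢ G uv) (adjacent⇒complement-nonadjacent G uv)))

-- Common neighbours and maximal cliques

commonNeighbours : Graph n → Fin n → Fin n → Subset n
commonNeighbours K u v = tabulate (λ z → adj K u z ∧ adj K v z)

MaximalCliquesAreTriangles : Graph n → Set
MaximalCliquesAreTriangles K = ∀ C → MaximalClique K C → ∣ C ∣ ≡ 3

EdgeTriangleBound : Graph n → ℕ → Set
EdgeTriangleBound K p = ∀ u v → Adjacent K u v → p ≤ triangleCount K u v

module _ (K : Graph n) where

  ∈commonNeighbours⁺ : ∀ {u v z} → Adjacent K u z → Adjacent K v z → z ∈ commonNeighbours K u v
  ∈commonNeighbours⁺ uz vz = ∈tabulate⁺ _ (cong₂ _∧_ uz vz)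

  ∈commonNeighbours⁻ : ∀ {u v z} → z ∈ commonNeighbours K u v → Adjacent K u z × Adjacent K v z
  ∈commonNeighbours⁻ {u} {v} {z} z∈ = ∧-≡-true⁻ (adj K u z) (adj K v z) (∈tabulate⁻ _ z∈)

  subsingleton⇒independent : ∀ {p} → Subsingleton p → Independent K p
  subsingleton⇒independent p-sub x y x∈ y∈ =
    subst (λ y → adj K x y ≡ false) (p-sub x∈ y∈) (irrefl K x)

  maximalClique-or-extension : ∀ {C} → Clique K C →
    MaximalClique K C ⊎ ∃ λ w → w ∉ C × ∀ c → c ∈ C → Adjacent K w c
  maximalClique-or-extension {C} C-clique
    with any? (λ w → ¬? (w ∈? C) ×-dec all? (λ c → c ∈? C →-dec adj K w c Bool.≟ true))
  ... | yes (w , w∉C , w-adj) = inj₂ (w , w∉C , w-adj)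
  ... | no ¬extension = inj₁ (C-clique , λ D D-clique C⊆D {d} d∈D → ∈C D-clique C⊆D d∈D)
    where
    ∈C : ∀ {D d} → Clique K D → C ⊆ D → d ∈ D → d ∈ C
    ∈C {d = d} D-clique C⊆D d∈D with d ∈? C
    ... | yes d∈C = d∈C
    ... | no  d∉C = contradiction (d , d∉C , λ c c∈C →
            D-clique d c d∈D (C⊆D c∈C) λ { refl → d∉C c∈C }) ¬extension

  smallClique-extends : MaximalCliquesAreTriangles K → ∀ {C} → Clique K C → ∣ C ∣ < 3 →
    ∃ λ w → ∀ c → c ∈ C → Adjacent K w c
  smallClique-extends triangles C-clique ∣C∣<3 with maximalClique-or-extension C-clique
  ... | inj₁ C-maximal        = contradiction (triangles _ C-maximal) (<⇒≢ ∣C∣<3)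
  ... | inj₂ (w , _ , w-adj)  = w , w-adj

  edge-in-triangle : MaximalCliquesAreTriangles K → EdgeTriangleBound K 1
  edge-in-triangle triangles u v uv
    with smallClique-extends triangles (allPairs⇒clique K ((uv ∷ []) ∷ [] ∷ []))
                              (s≤s (∣⟦xs⟧∣≤length (u ∷ v ∷ [])))
  ... | w , w-adj = ≤-trans (s≤s z≤n) (x∈p⇒∣p-x∣<∣p∣ (∈commonNeighbours⁺
          (adjacent-sym K (w-adj u (∈⟦⟧⁺ (u ∷ v ∷ []) (here refl))))
          (adjacent-sym K (w-adj v (∈⟦⟧⁺ (u ∷ v ∷ []) (there (here refl)))))))

-- Consequences of G ∈ W_p

singletons : List (Fin n) → ∀ q → Fin q → Subset n
singletons []       _       _       = ∅
singletons (x ∷ _)  (suc _) zero    = ⁅ x ⁆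
singletons (_ ∷ xs) (suc q) (suc j) = singletons xs q j

singletons-subsingleton : ∀ (xs : List (Fin n)) q j → Subsingleton (singletons xs q j)
singletons-subsingleton []       _       _       x∈ _  = ⊥-elim (∉⊥ x∈)
singletons-subsingleton (x ∷ _)  (suc _) zero    y∈ z∈ =
  trans (x∈⁅y⁆⇒x≡y x y∈) (sym (x∈⁅y⁆⇒x≡y x z∈))
singletons-subsingleton (_ ∷ xs) (suc q) (suc j) = singletons-subsingleton xs q j

∈singletons⇒∈ : ∀ {z : Fin n} xs q j → z ∈ singletons xs q j → z ∈ₗ xs
∈singletons⇒∈ []       _       _       z∈ = ⊥-elim (∉⊥ z∈)
∈singletons⇒∈ (x ∷ _)  (suc _) zero    z∈ = here (x∈⁅y⁆⇒x≡y x z∈)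
∈singletons⇒∈ (_ ∷ xs) (suc q) (suc j) z∈ = there (∈singletons⇒∈ xs q j z∈)

singletons-disjoint : ∀ {xs : List (Fin n)} → AllPairs _≢_ xs → ∀ q j k → j ≢ k →
  Disjoint (singletons xs q j) (singletons xs q k)
singletons-disjoint []               _       _       _       _   z z∈ _ = ∉⊥ z∈
singletons-disjoint (_ ∷ _)          (suc _) zero    zero    0≢0 = contradiction refl 0≢0
singletons-disjoint {xs = x ∷ xs} (x≢xs ∷ _) (suc q) zero (suc k) _ z z∈j z∈k =
  All.lookup x≢xs (∈singletons⇒∈ xs q k z∈k) (sym (x∈⁅y⁆⇒x≡y x z∈j))
singletons-disjoint {xs = x ∷ xs} (x≢xs ∷ _) (suc q) (suc j) zero _ z z∈j z∈k =
  All.lookup x≢xs (∈singletons⇒∈ xs q j z∈j) (sym (x∈⁅y⁆⇒x≡y x z∈k))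
singletons-disjoint (_ ∷ distinct)   (suc q) (suc j) (suc k) j≢k =
  singletons-disjoint distinct q j k (j≢k ∘ cong suc)

singletons-cover : ∀ {z : Fin n} xs q → length xs ≤ q → z ∈ₗ xs → ∃ λ j → z ∈ singletons xs q j
singletons-cover (x ∷ _)  (suc _) _         (here refl) = zero , x∈⁅x⁆ x
singletons-cover (_ ∷ xs) (suc q) (s≤s len) (there z∈) with singletons-cover xs q len z∈
... | j , z∈j = suc j , z∈j

IndependentPacking : ∀ {m} → Graph n → (Fin m → Subset n) → Set
IndependentPacking G F = (∀ i → Independent G (F i)) × (∀ i j → i ≢ j → Disjoint (F i) (F j))

module _ (G : Graph n) {q : ℕ} where

  W⇒extension : W G (suc q) → ∀ {A} → Independent G A → ∃ λ M → MaximumIndep G M × A ⊆ M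
  W⇒extension (_ , extend) {A} A-indep =
    let M , M-extends , _ = extend family family-indep family-disjoint in M zero , M-extends zero
    where
    family : Fin (suc q) → Subset n
    family zero    = A
    family (suc _) = ∅
    family-indep : ∀ i → Independent G (family i)
    family-indep zero    = A-indep
    family-indep (suc _) = subsingleton⇒independent G λ x∈ → ⊥-elim (∉⊥ x∈)
    family-disjoint : ∀ i j → i ≢ j → Disjoint (family i) (family j)
    family-disjoint zero    zero    0≢0 = contradiction refl 0≢0
    family-disjoint zero    (suc _) _   _ _ x∈ = ∉⊥ x∈
    family-disjoint (suc _) _       _   _ x∈ _ = ∉⊥ x∈

  W⇒WellCovered : W G (suc q) → WellCovered G
  W⇒WellCovered w A (A-indep , A-maximal) with W⇒extension w A-indep
  ... | M , (M-indep , M-max) , A⊆M =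
    A-indep , λ B B-indep → ≤-trans (M-max B B-indep) (p⊆q⇒∣p∣≤∣q∣ (A-maximal M M-indep A⊆M))

module _ (G : Graph n) (α3 : IsAlpha G 3) where

  private
    H = complement G

  maximum⇒size3 : ∀ {M} → MaximumIndep G M → ∣ M ∣ ≡ 3
  maximum⇒size3 M-max = IsAlpha-unique G (maximum⇒IsAlpha G M-max) α3

  WellCovered⇒maximalCliquesAreTriangles : WellCovered G → MaximalCliquesAreTriangles H
  WellCovered⇒maximalCliquesAreTriangles well-covered C (C-clique , C-maximal) =
    maximum⇒size3 (well-covered C (C-indep , λ B B-indep C⊆B →
      C-maximal B (independent⇒complement-clique G B-indep) C⊆B))
    where
    C-indep = complement-clique⇒independent G C-clique

  few-triangles⇒¬W : ∀ {q u v} → W G (suc q) → Adjacent H u v → triangleCount H u v ≤ q → ⊥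
  few-triangles⇒¬W {q} {u} {v} (_ , extend) uv few with enumeration (commonNeighbours H u v)
  ... | xs , len , xs⊆S , distinct , complete =
    let M , M-extends , M-disjoint = extend A A-indep A-disjoint
        M₀-max , A₀⊆M₀ = M-extends zero
        z , z∈M₀ , z≢u , z≢v = ∃-other u v (≤-reflexive (sym (maximum⇒size3 M₀-max)))
        M₀-clique = independent⇒complement-clique G (proj₁ M₀-max)
        u∈M₀ = A₀⊆M₀ (∈⟦⟧⁺ (u ∷ v ∷ []) (here refl))
        v∈M₀ = A₀⊆M₀ (∈⟦⟧⁺ (u ∷ v ∷ []) (there (here refl)))
        z∈S = ∈commonNeighbours⁺ H (M₀-clique u z u∈M₀ z∈M₀ (z≢u ∘ sym))
                                   (M₀-clique v z v∈M₀ z∈M₀ (z≢v ∘ sym))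
        j , z∈Aⱼ = singletons-cover xs q (≤-trans (≤-reflexive len) few) (complete z∈S)
    in M-disjoint zero (suc j) (λ ()) z z∈M₀ (proj₂ (M-extends (suc j)) z∈Aⱼ)
    where
    A : Fin (suc q) → Subset n
    A zero    = ⟦ u ∷ v ∷ [] ⟧
    A (suc j) = singletons xs q j
    A-indep : ∀ i → Independent G (A i)
    A-indep zero    = complement-clique⇒independent G (allPairs⇒clique H ((uv ∷ []) ∷ [] ∷ []))
    A-indep (suc j) = subsingleton⇒independent G (singletons-subsingleton xs q j)
    endpoint∉S : ∀ {z} → z ∈ₗ u ∷ v ∷ [] → z ∉ commonNeighbours H u v
    endpoint∉S (here refl)         z∈S = adjacent⇒≢ H (proj₁ (∈commonNeighbours⁻ H z∈S)) refl
    endpoint∉S (there (here refl)) z∈S = adjacent⇒≢ H (proj₂ (∈commonNeighbours⁻ H z∈S)) refl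
    A₀∩Aⱼ : ∀ j {z} → z ∈ A zero → z ∉ A (suc j)
    A₀∩Aⱼ j z∈A₀ z∈Aⱼ =
      endpoint∉S (∈⟦⟧⁻ (u ∷ v ∷ []) z∈A₀) (All.lookup xs⊆S (∈singletons⇒∈ xs q j z∈Aⱼ))
    A-disjoint : ∀ i j → i ≢ j → Disjoint (A i) (A j)
    A-disjoint zero    zero    0≢0 = contradiction refl 0≢0
    A-disjoint zero    (suc k) _   z z∈A₀ z∈Aₖ = A₀∩Aⱼ k z∈A₀ z∈Aₖ
    A-disjoint (suc j) zero    _   z z∈Aⱼ z∈A₀ = A₀∩Aⱼ j z∈A₀ z∈Aⱼ
    A-disjoint (suc j) (suc k) j≢k = singletons-disjoint distinct q j k (j≢k ∘ cong suc)

  W⇒edgeTriangleBound : ∀ {q} → W G (suc q) → EdgeTriangleBound H (suc q)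
  W⇒edgeTriangleBound {q} w u v uv with suc q ≤? triangleCount H u v
  ... | yes bound = bound
  ... | no ¬bound = ⊥-elim (few-triangles⇒¬W w uv (≤-pred (≰⇒> ¬bound)))

-- Extending disjoint independent sets greedily

∃-avoiding : ∀ {q} (O : Fin q → Subset n) {S} → (∀ k → Subsingleton (S ∩ O k)) → q < ∣ S ∣ →
  ∃ λ z → z ∈ S × ∀ k → z ∉ O k
∃-avoiding {q = zero} O _ 0<∣S∣ = let z , z∈S = nonempty⁺ 0<∣S∣ in z , z∈S , λ ()
∃-avoiding {q = suc q} O {S} meets q<∣S∣ with nonempty? (S ∩ O zero)
... | no S∩O₀-empty =
  let z , z∈S , avoids = ∃-avoiding (O ∘ suc) (meets ∘ suc) (≤-trans (n≤1+n _) q<∣S∣)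
  in z , z∈S , λ { zero z∈O₀ → S∩O₀-empty (z , x∈p∩q⁺ (z∈S , z∈O₀)) ; (suc k) → avoids k }
... | yes (z₀ , z₀∈S∩O₀) =
  let z , z∈S-z₀ , avoids = ∃-avoiding (O ∘ suc) {S - z₀}
                              (λ k z∈ z′∈ → meets (suc k) (shrink z∈) (shrink z′∈))
                              (≤-pred (≤-trans q<∣S∣ (∣p∣≤1+∣p-x∣ S z₀)))
      z∈S = p─q⊆p S ⁅ z₀ ⁆ z∈S-z₀
  in z , z∈S , λ { zero z∈O₀ → x∈p-y⇒x≢y z∈S-z₀ (meets zero (x∈p∩q⁺ (z∈S , z∈O₀)) z₀∈S∩O₀)
                 ; (suc k) → avoids k }
  where
  shrink : ∀ {k z} → z ∈ (S - z₀) ∩ O k → z ∈ S ∩ O k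
  shrink z∈ = let z∈S-z₀ , z∈Oₖ = x∈p∩q⁻ _ _ z∈ in x∈p∩q⁺ (p─q⊆p S ⁅ z₀ ⁆ z∈S-z₀ , z∈Oₖ)

module _ (G : Graph n) where

  private
    H = complement G

  independent-∪⁅⁆ : ∀ {C z} → Independent G C → (∀ c → c ∈ C → Adjacent H c z) →
    Independent G (C ∪ ⁅ z ⁆)
  independent-∪⁅⁆ {C} {z} C-indep z-adj x y x∈ y∈ with x∈p∪q⁻ C ⁅ z ⁆ x∈ | x∈p∪q⁻ C ⁅ z ⁆ y∈
  ... | inj₁ x∈C | inj₁ y∈C = C-indep x y x∈C y∈C
  ... | inj₁ x∈C | inj₂ y∈z rewrite x∈⁅y⁆⇒x≡y z y∈z = complement-adjacent⁻ G (z-adj x x∈C)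
  ... | inj₂ x∈z | inj₁ y∈C rewrite x∈⁅y⁆⇒x≡y z x∈z =
    complement-adjacent⁻ G (adjacent-sym H (z-adj y y∈C))
  ... | inj₂ x∈z | inj₂ y∈z rewrite x∈⁅y⁆⇒x≡y z x∈z | x∈⁅y⁆⇒x≡y z y∈z = irrefl G z

  commonNeighbours-∩-independent : ¬ HasK4 H → ∀ {u v A} → Adjacent H u v → Independent G A →
    Subsingleton (commonNeighbours H u v ∩ A)
  commonNeighbours-∩-independent noK4 {u} {v} {A} uv A-indep {z} {z′} z∈ z′∈ with z ≟ᶠ z′
  ... | yes z≡z′ = z≡z′
  ... | no  z≢z′ =
    let z∈S , z∈A = x∈p∩q⁻ _ A z∈
        z′∈S , z′∈A = x∈p∩q⁻ _ A z′∈
        uz , vz = ∈commonNeighbours⁻ H z∈S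
        uz′ , vz′ = ∈commonNeighbours⁻ H z′∈S
    in ⊥-elim (noK4 (u , v , z , z′ , uv , uz , uz′ , vz , vz′ ,
                     complement-adjacent⁺ G (A-indep z z′ z∈A z′∈A) z≢z′))

  ∃-freeCommonNeighbour : ¬ HasK4 H → ∀ {q} → EdgeTriangleBound H (suc q) →
    (O : Fin q → Subset n) → (∀ k → Independent G (O k)) →
    ∀ {u v} → Adjacent H u v → ∃ λ z → Adjacent H u z × Adjacent H v z × ∀ k → z ∉ O k
  ∃-freeCommonNeighbour noK4 bound O O-indep {u} {v} uv
    with ∃-avoiding O (λ k → commonNeighbours-∩-independent noK4 uv (O-indep k)) (bound u v uv)
  ... | z , z∈S , avoids = let uz , vz = ∈commonNeighbours⁻ H z∈S in z , uz , vz , avoids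

  ∃-edge : IsAlpha G 3 → ∃ λ u → ∃ λ v → Adjacent H u v
  ∃-edge ((A , A-indep , ∣A∣≡3) , _)
    with ∃-distinct⊆ 2 {A} (≤-trans (n≤1+n 2) (≤-reflexive (sym ∣A∣≡3)))
  ... | u ∷ v ∷ [] , refl , u∈ ∷ v∈ ∷ [] , (u≢v ∷ []) ∷ _ =
    u , v , independent⇒complement-clique G A-indep u v u∈ v∈ u≢v

  ∃-coveringEdge : IsAlpha G 3 → MaximalCliquesAreTriangles H →
    ∀ {C} → Independent G C → ∣ C ∣ < 3 →
    ∃ λ u → ∃ λ v → Adjacent H u v × ∀ c → c ∈ C → c ≡ u ⊎ c ≡ v
  ∃-coveringEdge α3 triangles {C} C-indep ∣C∣<3 with enumeration C
  ... | [] , _ , _ , _ , complete =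
    let u , v , uv = ∃-edge α3 in u , v , uv , λ c c∈C → contradiction (complete c∈C) λ ()
  ... | x ∷ [] , _ , x∈C ∷ [] , _ , complete =
    let w , w-adj = smallClique-extends H triangles (independent⇒complement-clique G C-indep) ∣C∣<3
    in x , w , adjacent-sym H (w-adj x x∈C) , λ c c∈C → inj₁ (singleton⁻ (complete c∈C))
  ... | x ∷ y ∷ [] , _ , x∈C ∷ y∈C ∷ [] , (x≢y ∷ []) ∷ _ , complete =
    x , y , independent⇒complement-clique G C-indep x y x∈C y∈C x≢y ,
    λ c c∈C → ∈-pair⁻ (complete c∈C)
  ... | _ ∷ _ ∷ _ ∷ _ , len , _ =
    contradiction (subst (_< 3) (sym len) ∣C∣<3) λ { (s≤s (s≤s (s≤s ()))) }

updateAt-view : ∀ {A : Set} {m} (F : Fin m → A) i x j →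
  (j ≡ i × updateAt F i (const x) j ≡ x) ⊎ (j ≢ i × updateAt F i (const x) j ≡ F j)
updateAt-view F i x j with j ≟ᶠ i
... | yes refl = inj₁ (refl , updateAt-updates i F)
... | no  j≢i  = inj₂ (j≢i , updateAt-minimal j i F j≢i)

updateAt-⊇ : ∀ {m} {F : Fin m → Subset n} {i M} → F i ⊆ M → ∀ j → F j ⊆ updateAt F i (const M) j
updateAt-⊇ {F = F} {i} {M} Fᵢ⊆M j with updateAt-view F i M j
... | inj₁ (refl , eq) = subst (F j ⊆_) (sym eq) Fᵢ⊆M
... | inj₂ (_ , eq)    = ⊆-reflexive (sym eq)

module _ (G : Graph n) {m : ℕ} {F : Fin m → Subset n} where

  updateAt-packing : IndependentPacking G F → ∀ {i M} → Independent G M →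
    (∀ j → j ≢ i → Disjoint M (F j)) → IndependentPacking G (updateAt F i (const M))
  updateAt-packing (F-indep , F-disjoint) {i} {M} M-indep M-avoids = indep , disjoint
    where
    indep : ∀ j → Independent G (updateAt F i (const M) j)
    indep j with updateAt-view F i M j
    ... | inj₁ (_ , eq) = subst (Independent G) (sym eq) M-indep
    ... | inj₂ (_ , eq) = subst (Independent G) (sym eq) (F-indep j)
    disjoint : ∀ j k → j ≢ k → Disjoint (updateAt F i (const M) j) (updateAt F i (const M) k)
    disjoint j k j≢k with updateAt-view F i M j | updateAt-view F i M k
    ... | inj₁ (refl , _)  | inj₁ (refl , _)  = contradiction refl j≢k
    ... | inj₁ (_ , eqⱼ)   | inj₂ (k≢i , eqₖ) = subst₂ Disjoint (sym eqⱼ) (sym eqₖ) (M-avoids k k≢i)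
    ... | inj₂ (j≢i , eqⱼ) | inj₁ (_ , eqₖ)   =
      subst₂ Disjoint (sym eqⱼ) (sym eqₖ) λ z z∈Fⱼ z∈M → M-avoids j j≢i z z∈M z∈Fⱼ
    ... | inj₂ (_ , eqⱼ)   | inj₂ (_ , eqₖ)   =
      subst₂ Disjoint (sym eqⱼ) (sym eqₖ) (F-disjoint j k j≢k)

module _ (G : Graph n) (α3 : IsAlpha G 3) (noK4 : ¬ HasK4 (complement G))
         (triangles : MaximalCliquesAreTriangles (complement G))
         {q : ℕ} (bound : EdgeTriangleBound (complement G) (suc q)) where

  private
    H = complement G

  growAvoiding : (O : Fin q → Subset n) → (∀ k → Independent G (O k)) →
    ∀ {C} → Independent G C → (∀ k → Disjoint C (O k)) → ∣ C ∣ < 3 →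
    ∃ λ C′ → C ⊂ C′ × Independent G C′ × ∀ k → Disjoint C′ (O k)
  growAvoiding O O-indep {C} C-indep C-avoids ∣C∣<3 with ∃-coveringEdge G α3 triangles C-indep ∣C∣<3
  ... | u , v , uv , covered with ∃-freeCommonNeighbour G noK4 bound O O-indep uv
  ... | z , uz , vz , z-avoids =
    C ∪ ⁅ z ⁆ , (p⊆p∪q _ , z , q⊆p∪q C _ (x∈⁅x⁆ z) , z∉C) ,
    independent-∪⁅⁆ G C-indep adjacent-z , avoids
    where
    adjacent-z : ∀ c → c ∈ C → Adjacent H c z
    adjacent-z c c∈C with covered c c∈C
    ... | inj₁ refl = uz
    ... | inj₂ refl = vz
    z∉C : z ∉ C
    z∉C z∈C = adjacent⇒≢ H (adjacent-z z z∈C) refl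
    avoids : ∀ k → Disjoint (C ∪ ⁅ z ⁆) (O k)
    avoids k x x∈ x∈Oₖ with x∈p∪q⁻ C ⁅ z ⁆ x∈
    ... | inj₁ x∈C = C-avoids k x x∈C x∈Oₖ
    ... | inj₂ x∈z = z-avoids k (subst (_∈ O k) (x∈⁅y⁆⇒x≡y z x∈z) x∈Oₖ)

  maximiseAvoiding : ∀ fuel (O : Fin q → Subset n) → (∀ k → Independent G (O k)) →
    ∀ {C} → Independent G C → (∀ k → Disjoint C (O k)) → 3 ≤ fuel + ∣ C ∣ →
    ∃ λ M → MaximumIndep G M × C ⊆ M × ∀ k → Disjoint M (O k)
  maximiseAvoiding zero O O-indep C-indep C-avoids 3≤∣C∣ =
    _ , large⇒maximum G α3 C-indep 3≤∣C∣ , id , C-avoids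
  maximiseAvoiding (suc fuel) O O-indep {C} C-indep C-avoids enough with 3 ≤? ∣ C ∣
  ... | yes 3≤∣C∣ = C , large⇒maximum G α3 C-indep 3≤∣C∣ , id , C-avoids
  ... | no  3≰∣C∣ with growAvoiding O O-indep C-indep C-avoids (≰⇒> 3≰∣C∣)
  ... | C′ , C⊂C′ , C′-indep , C′-avoids
    with maximiseAvoiding fuel O O-indep C′-indep C′-avoids
           (≤-trans enough (≤-trans (≤-reflexive (sym (+-suc fuel ∣ C ∣)))
                                    (+-monoʳ-≤ fuel (p⊂q⇒∣p∣<∣q∣ C⊂C′))))
  ... | M , M-max , C′⊆M , M-avoids = M , M-max , C′⊆M ∘ proj₁ C⊂C′ , M-avoids

  maximisePackingAt : ∀ {F : Fin (suc q) → Subset n} → IndependentPacking G F → ∀ i →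
    ∃ λ F′ → IndependentPacking G F′ × (∀ j → F j ⊆ F′ j) × MaximumIndep G (F′ i)
  maximisePackingAt {F} F-packing@(F-indep , F-disjoint) i
    with maximiseAvoiding 3 (F ∘ punchIn i) (F-indep ∘ punchIn i) (F-indep i)
           (λ k → F-disjoint i (punchIn i k) (punchInᵢ≢i i k ∘ sym)) (m≤m+n 3 _)
  ... | M , M-max , Fᵢ⊆M , M-avoids =
    updateAt F i (const M) , updateAt-packing G F-packing (proj₁ M-max) M-avoids′ ,
    updateAt-⊇ Fᵢ⊆M , subst (MaximumIndep G) (sym (updateAt-updates i F)) M-max
    where
    M-avoids′ : ∀ j → j ≢ i → Disjoint M (F j)
    M-avoids′ j j≢i =
      subst (Disjoint M ∘ F) (punchIn-punchOut (j≢i ∘ sym)) (M-avoids (punchOut (j≢i ∘ sym)))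

  maximisePacking : ∀ {F : Fin (suc q) → Subset n} → IndependentPacking G F →
    (L : List (Fin (suc q))) →
    ∃ λ F′ → IndependentPacking G F′ × (∀ j → F j ⊆ F′ j) × All (MaximumIndep G ∘ F′) L
  maximisePacking {F} F-packing [] = F , F-packing , (λ _ → id) , []
  maximisePacking F-packing (i ∷ L) with maximisePacking F-packing L
  ... | F₁ , F₁-packing , F⊆F₁ , F₁-max with maximisePackingAt F₁-packing i
  ... | F₂ , F₂-packing , F₁⊆F₂ , F₂ᵢ-max =
    F₂ , F₂-packing , (λ j → F₁⊆F₂ j ∘ F⊆F₁ j) ,
    F₂ᵢ-max ∷ All.map (λ {j} F₁ⱼ-max → maximum-⊆ G F₁ⱼ-max (F₁⊆F₂ j) (proj₁ F₂-packing j)) F₁-max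

  triangles⇒W : W G (suc q)
  triangles⇒W = q<n , λ A A-indep A-disjoint →
    let F , (_ , F-disjoint) , A⊆F , F-max = maximisePacking (A-indep , A-disjoint) (allFin _)
    in F , (λ i → All.lookup F-max (∈-allFin i) , A⊆F i) , F-disjoint
    where
    q<n : suc q ≤ n
    q<n = let u , v , uv = ∃-edge G α3 in ≤-trans (bound u v uv) (∣p∣≤n (commonNeighbours H u v))

∃-minimiser : ∀ {A : Set} {P : A → Set} → Decidable P → (f : A → ℕ) (xs : List A) → ∀ {a} → P a →
  ∃ λ b → P b × ∀ c → c ∈ₗ xs → P c → f b ≤ f c
∃-minimiser P? f xs {a} Pa =
  argmin f a ys , argmin-all f Pa (all-filter P? xs) ,
  λ c c∈xs Pc → All.lookup (f[argmin]≤f[xs] a ys) (∈-filter⁺ P? c∈xs Pc)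
  where
  ys = filter P? xs

∃-minTriangleCount : ∀ (K : Graph n) {u v} → Adjacent K u v → ∃ λ m → IsMinTriangleCount K m
∃-minTriangleCount {n} K {u₀} {v₀} u₀v₀
  with ∃-minimiser (λ (x , y) → adj K x y Bool.≟ true) (λ (x , y) → triangleCount K x y)
                   (cartesianProduct (allFin n) (allFin n)) {u₀ , v₀} u₀v₀
... | (u , v) , uv , minimal =
  triangleCount K u v , (u , v , uv , refl) ,
  λ x y xy → minimal (x , y) (∈-cartesianProduct⁺ (∈-allFin x) (∈-allFin y)) xy

module _ (G : Graph n) (α3 : IsAlpha G 3) where

  private
    H = complement G

  alphaCritical×W⇔conditions : ∀ q → (AlphaCritical G × W G (suc q))
    ⇔ (K4Saturated H × MaximalCliquesAreTriangles H × EdgeTriangleBound H (suc q))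
  alphaCritical×W⇔conditions q = mk⇔
    (λ (critical , w) →
      to critical , WellCovered⇒maximalCliquesAreTriangles G α3 (W⇒WellCovered G w) ,
      W⇒edgeTriangleBound G α3 w)
    (λ (saturated , triangles , bound) →
      from saturated , triangles⇒W G α3 (proj₁ saturated) triangles bound)
    where
    open Equivalence (alphaCritical⇔K4Saturated G α3)

  w≡minTriangleCount : MaximalCliquesAreTriangles H → ∃ λ m → IsW G m × IsMinTriangleCount H m
  w≡minTriangleCount triangles with ∃-minTriangleCount H (proj₂ (proj₂ (∃-edge G α3)))
  ... | zero , (u , v , uv , count≡0) , _ =
    contradiction (subst (1 ≤_) count≡0 (edge-in-triangle H triangles u v uv)) λ ()
  ... | suc q , minimiser@(u , v , uv , count≡m) , minimal =
    suc q , (s≤s z≤n , triangles⇒W G α3 (¬HasK4-complement G α3) triangles minimal , maximal) ,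
    minimiser , minimal
    where
    maximal : ∀ p → 1 ≤ p → W G p → p ≤ suc q
    maximal (suc p) _ w = subst (suc p ≤_) count≡m (W⇒edgeTriangleBound G α3 w u v uv)

corollary6p2 : ∀ {n} (G : Graph n) → IsAlpha G 3 →
    (∀ (p : ℕ) → 1 ≤ p →
      ((AlphaCritical G × W G p)
        ⇔ (K4Saturated (complement G)
           × (∀ C → MaximalClique (complement G) C → ∣ C ∣ ≡ 3)
           × (∀ u v → adj (complement G) u v ≡ true → p ≤ triangleCount (complement G) u v))))
    × (AlphaCritical G → WellCovered G →
       ∃ λ m → IsW G m × IsMinTriangleCount (complement G) m)
corollary6p2 G α3 =
  (λ { (suc q) _ → alphaCritical×W⇔conditions G α3 q }) ,
  λ _ well-covered →
    w≡minTriangleCount G α3 (WellCovered⇒maximalCliquesAreTriangles G α3 well-covered)
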